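{- Let $G=(V,E)$ satisfy the standing assumptions and have highway dimension at most $h$. Let $k\ge 0$ and $\lambda>0$. There is a constant $c$ depending only on $h,k,\lambda$ such that: for every $r>0$, every $(r,k)$ vertex cover $C$ of $G$, every $r'>0$ with $r'/r\le\lambda$, and every $v\in V$, the sum over the vertices $u\in B(v,r')\cap C$ of the degree of $u$ in the shortcut graph $G(C,r')$ is at most $c$.
   Context: Standing assumptions: $G$ is a finite connected undirected graph, edge weights at least $1$, shortest paths unique ($p(u,w)$, length $d(u,w)$), every edge is the shortest path between its endpoints. $B(v,r)=\{v': d(v,v')\le r\}$; $\mathrm{maxedge}(p)$ is the maximum edge weight on path $p$. Highway dimension: an $r$-witness of a shortest path $p$ from $u$ to $w$ is a shortest path $p'$ of length at least $r$ containing $p$, with endpoints $u$ or a neighbor of $u$, and $w$ or a neighbor of $w$; $p$ is $r$-significant if it has one; $d(v,q)$ is the distance from $v$ to the nearest vertex of $q$; $S(v,r)$ is the set of $r$-significant paths with an $r$-witness $p'$ satisfying $d(v,p')\le 2r$; the highway dimension is the least $h$ such that for all $r>0,v\in V$ some $C\subseteq V$, $|C|\le h$, meets every path of $S(v,r)$. An $(r,k)$ vertex cover is a set $C\subseteq V$ such that (1) every shortest path $p(v_1,v_2)$ with $d(v_1,v_2)>r$ and $\mathrm{maxedge}(p(v_1,v_2))\le r$ contains a vertex of $C$, and (2) $|B(v,2r)\cap C|\le k$ for all $v\in V$. For $C\subseteq V$ and $r>0$, the shortcut graph $G(C,r)$ has vertex set $C$ and an edge $\{v_1,v_2\}$ of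 weight $d(v_1,v_2)$ iff $d(v_1,v_2)\le r$ and $p(v_1,v_2)$ contains no element of $C$ other than $v_1,v_2$.
   Formalization: The edge weights, the parameters r, r′ and λ, and the radii r in the definition of highway dimension are all rational. -}

module Defs where

open import Data.Nat as ℕ using (ℕ)
open import Data.Fin using (Fin; _≟_)
open import Data.Fin.Subset as Sub using (Subset)
open import Data.Fin.Subset.Properties using (_∈?_)
open import Data.List using (List; []; _∷_; _++_; length; filter; allFin; map)
open import Data.Nat.ListAction using (sum)
open import Data.List.Membership.Propositional as LMem using ()
open import Data.List.Relation.Unary.All as All using (All)
open import Data.Rational using (ℚ; 0ℚ; 1ℚ; _+_; _*_; _≤_; _<_; _⊔_)
open import Data.Rational.Properties using (_≤?_)
open import Data.Product using (Σ; ∃; _×_; _,_)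
open import Data.Sum using (_⊎_)
open import Relation.Nullary using (¬_; Dec)
open import Relation.Nullary.Decidable using (_×-dec_; _→-dec_; _⊎-dec_; ¬?)
open import Relation.Binary.PropositionalEquality using (_≡_)

data WalkFT {n : ℕ} (adj : Fin n → Fin n → Set) : Fin n → Fin n → List (Fin n) → Set where
  here : ∀ u → WalkFT adj u u (u ∷ [])
  step : ∀ {u x v p} → adj u x → WalkFT adj x v p → WalkFT adj u v (u ∷ p)

len : {n : ℕ} → (Fin n → Fin n → ℚ) → List (Fin n) → ℚ
len w (a ∷ b ∷ p) = w a b + len w (b ∷ p)
len w _ = 0ℚ

maxEdge : {n : ℕ} → (Fin n → Fin n → ℚ) → List (Fin n) → ℚ
maxEdge w (a ∷ b ∷ p) = w a b ⊔ maxEdge w (b ∷ p)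
maxEdge w _ = 0ℚ

-- Finite connected undirected weighted graph on vertex set Fin n satisfying the
-- standing assumptions: weights ≥ 1, shortest paths exist and are unique
-- (sp u v is THE shortest path p(u,v)), every edge is the shortest path
-- between its endpoints.
record Graph (n : ℕ) : Set₁ where
  field
    adj       : Fin n → Fin n → Set
    adj-irrefl : ∀ u → ¬ adj u u
    adj-sym   : ∀ {u v} → adj u v → adj v u
    w         : Fin n → Fin n → ℚ
    w-sym     : ∀ u v → w u v ≡ w v u
    w-≥1      : ∀ {u v} → adj u v → 1ℚ ≤ w u v
    sp        : Fin n → Fin n → List (Fin n)
    sp-walk   : ∀ u v → WalkFT adj u v (sp u v)
    sp-min    : ∀ u v q → WalkFT adj u v q → len w (sp u v) ≤ len w q
    sp-unique : ∀ u v q → WalkFT adj u v q → len w q ≤ len w (sp u v) → q ≡ sp u v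
    edge-sp   : ∀ {u v} → adj u v → sp u v ≡ u ∷ v ∷ []

module _ {n : ℕ} (G : Graph n) where
  open Graph G

  d : Fin n → Fin n → ℚ
  d u v = len w (sp u v)

  Contains : List (Fin n) → List (Fin n) → Set
  Contains p' p = Σ (List (Fin n)) λ xs → Σ (List (Fin n)) λ ys → p' ≡ xs ++ (p ++ ys)

  SelfOrNbr : Fin n → Fin n → Set
  SelfOrNbr u x = x ≡ u ⊎ adj u x

  Witness : ℚ → Fin n → Fin n → Fin n → Fin n → Set
  Witness r u v a b = SelfOrNbr u a × SelfOrNbr v b × r ≤ d a b × Contains (sp a b) (sp u v)

  DistToPathLe : Fin n → List (Fin n) → ℚ → Set
  DistToPathLe x q t = ∃ λ y → y LMem.∈ q × d x y ≤ t

  InS : Fin n → ℚ → Fin n → Fin n → Set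
  InS x r u v = ∃ λ a → ∃ λ b → Witness r u v a b × DistToPathLe x (sp a b) (r + r)

  HighwayDimLe : ℕ → Set
  HighwayDimLe h = ∀ (r : ℚ) → 0ℚ < r → ∀ (x : Fin n) →
    ∃ λ (C : Subset n) → Sub.∣ C ∣ ℕ.≤ h ×
      (∀ u v → InS x r u v → ∃ λ y → y LMem.∈ sp u v × y Sub.∈ C)

  ballCount : Subset n → Fin n → ℚ → ℕ
  ballCount C x t = length (filter (λ y → (y ∈? C) ×-dec (d x y ≤? t)) (allFin n))

  VertexCover : ℚ → ℕ → Subset n → Set
  VertexCover r k C =
    (∀ v₁ v₂ → r < d v₁ v₂ → maxEdge w (sp v₁ v₂) ≤ r →
       ∃ λ y → y LMem.∈ sp v₁ v₂ × y Sub.∈ C)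
    × (∀ x → ballCount C x (r + r) ℕ.≤ k)

  ShortcutEdge : Subset n → ℚ → Fin n → Fin n → Set
  ShortcutEdge C t u x =
    u Sub.∈ C × x Sub.∈ C × ¬ (u ≡ x) × d u x ≤ t ×
    All (λ y → y Sub.∈ C → y ≡ u ⊎ y ≡ x) (sp u x)

  shortcutEdge? : ∀ C t u x → Dec (ShortcutEdge C t u x)
  shortcutEdge? C t u x =
    (u ∈? C) ×-dec (x ∈? C) ×-dec ¬? (u ≟ x) ×-dec (d u x ≤? t) ×-dec
    All.all? (λ y → (y ∈? C) →-dec ((y ≟ u) ⊎-dec (y ≟ x))) (sp u x)

  shortcutDeg : Subset n → ℚ → Fin n → ℕ
  shortcutDeg C t u = length (filter (shortcutEdge? C t u) (allFin n))

  ballDegSum : Subset n → Fin n → ℚ → ℕ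
  ballDegSum C x t =
    sum (map (shortcutDeg C t) (filter (λ y → (y ∈? C) ×-dec (d x y ≤? t)) (allFin n)))

{-# OPTIONS --safe #-}
module Submission where

-- Only the packing half of the (r,k) vertex cover is used.  Highway dimension h
-- makes C doubling: let H, |H| ≤ h, hit S(x,R).  Every u with d(x,u) ≤ 2R is
-- within R of x or of a vertex of H: walking along p(x,u), let b be the first
-- vertex with d(b,u) < R and a its predecessor; p(a,u) is an R-witness of
-- p(b,u) passing through u, so p(b,u) ∈ S(x,R) and the vertex of H on it is
-- within R of u.  Hence |B(x,2R) ∩ C| ≤ (h+1) max_y |B(y,R) ∩ C|, and from
-- |B(y,2r) ∩ C| ≤ k we get |B(y,2^(N+1) r) ∩ C| ≤ K = (h+1)^N k, where the
-- integer N ≥ λ makes 2^(N+1) r ≥ λ r ≥ r′.  Neighbours of u in G(C,r′) lie in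
-- B(u,r′) ∩ C, so the sum has at most K terms, each at most K: c = K².

open import Defs
open import Data.Nat using (ℕ; _≤_)
open import Data.Fin using (Fin)
open import Data.Fin.Subset using (Subset)
open import Data.Rational using (ℚ; 0ℚ; _*_; _<_)
open import Data.Product using (∃)

open import Data.Nat as ℕ using (zero; suc; _+_; _^_; z≤n; s≤s)
open import Data.Nat.Properties
  using ( ≤-trans; ≤-reflexive; m≤n⇒m≤1+n; +-suc; +-monoʳ-≤; +-mono-≤; *-monoˡ-≤; *-identityˡ; *-assoc
        ; module ≤-Reasoning)
open import Data.Nat.ListAction using (sum)
open import Data.Integer as ℤ using (+_; -[1+_]; +≤+; -≤+)
import Data.Integer.Properties as ℤ
import Data.Rational as ℚ
open import Data.Rational using (mkℚ; 1ℚ; _/_; *≤*)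
open import Data.Rational.Literals using (fromℤ)
import Data.Rational.Properties as ℚ
open import Data.Fin as Fin using (suc)
open import Data.Fin.Subset as Sub using (inside; outside; ∣_∣)
open import Data.Vec using ([]; _∷_)
open import Data.Fin.Subset.Properties using (_∈?_)
open import Data.List using (List; []; _∷_; [_]; _++_; length; filter; map; tabulate; allFin)
open import Data.List.Properties using (length-map; map-tabulate; filter-none; ++-identityʳ)
open import Data.List.Membership.Propositional using (_∈_)
open import Data.List.Membership.Propositional.Properties using (∈-filter⁺; ∈-allFin)
open import Data.List.Relation.Unary.All as All using ()
open import Data.List.Relation.Unary.Any using (here; there)
open import Data.List.Relation.Binary.Sublist.Propositional using (⊆-refl)
open import Data.List.Relation.Binary.Sublist.Propositional.Properties using (filter⁺; length-mono-≤)
open import Data.Product using (_×_; _,_; proj₁; proj₂)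
open import Data.Sum using (inj₁; inj₂)
open import Data.Bool using (true; false)
open import Data.Empty using (⊥-elim)
open import Function using (_∘_; id)
open import Level using (0ℓ)
open import Relation.Nullary using (¬_; yes; no; does)
open import Relation.Nullary.Decidable using (_×-dec_)
open import Relation.Unary using (Pred; Decidable; _⊆_)
open import Relation.Unary.Properties using (_∩?_; ∁?)
open import Relation.Binary.PropositionalEquality
  using (_≡_; refl; sym; trans; cong; subst; module ≡-Reasoning)

module _ {A : Set} where

  module _ {P Q : Pred A 0ℓ} (P? : Decidable P) (Q? : Decidable Q) where

    length-filter-mono : P ⊆ Q → ∀ xs → length (filter P? xs) ≤ length (filter Q? xs)
    length-filter-mono P⊆Q xs =
      length-mono-≤ (filter⁺ P? Q? (λ { refl → P⊆Q }) (⊆-refl {x = xs}))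

    length-filter-split : ∀ xs →
      length (filter P? xs) ≤ length (filter Q? xs) + length (filter (P? ∩? ∁? Q?) xs)
    length-filter-split [] = z≤n
    length-filter-split (x ∷ xs) with P? x | Q? x
    ... | yes _ | yes _ = s≤s (length-filter-split xs)
    ... | yes _ | no _  = ≤-trans (s≤s (length-filter-split xs)) (≤-reflexive (sym (+-suc _ _)))
    ... | no _  | yes _ = m≤n⇒m≤1+n (length-filter-split xs)
    ... | no _  | no _  = length-filter-split xs

  length-filter-≤-sum : {B : Set} {P : Pred A 0ℓ} (P? : Decidable P)
    {Q : B → Pred A 0ℓ} (Q? : ∀ c → Decidable (Q c)) (cs : List B) →
    (∀ {y} → P y → ∃ λ c → c ∈ cs × Q c y) →
    ∀ xs → length (filter P? xs) ≤ sum (map (λ c → length (filter (Q? c) xs)) cs)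
  length-filter-≤-sum P? {Q} Q? [] covered xs =
    ≤-reflexive (cong length (filter-none P? (All.universal (λ y Py → uncovered (covered Py)) xs)))
    where
    uncovered : ∀ {y} → ¬ (∃ λ c → c ∈ [] × Q c y)
    uncovered (_ , () , _)
  length-filter-≤-sum {P = P} P? {Q} Q? (c ∷ cs) covered xs =
    ≤-trans (length-filter-split P? (Q? c) xs)
            (+-monoʳ-≤ _ (length-filter-≤-sum (P? ∩? ∁? (Q? c)) Q? cs covered-by-rest xs))
    where
    covered-by-rest : ∀ {y} → P y × ¬ Q c y → ∃ λ c′ → c′ ∈ cs × Q c′ y
    covered-by-rest (Py , ¬Qcy) with covered Py
    ... | _ , here refl , Qcy = ⊥-elim (¬Qcy Qcy)
    ... | c′ , there c′∈cs , Qc′y = c′ , c′∈cs , Qc′y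

sum-map-≤ : {B : Set} (f : B → ℕ) {K : ℕ} → (∀ c → f c ≤ K) →
            ∀ cs → sum (map f cs) ≤ length cs ℕ.* K
sum-map-≤ f f≤K [] = z≤n
sum-map-≤ f f≤K (c ∷ cs) = +-mono-≤ (f≤K c) (sum-map-≤ f f≤K cs)

filter-∈-map-suc : ∀ {n} s (p : Subset n) xs →
  filter (_∈? s ∷ p) (map suc xs) ≡ map suc (filter (_∈? p) xs)
filter-∈-map-suc s p [] = refl
filter-∈-map-suc s p (x ∷ xs) with does (x ∈? p)
... | true  = cong (suc x ∷_) (filter-∈-map-suc s p xs)
... | false = filter-∈-map-suc s p xs

length-filter-∈-tail : ∀ {n} s (p : Subset n) →
  length (filter (_∈? s ∷ p) (tabulate suc)) ≡ length (filter (_∈? p) (allFin n))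
length-filter-∈-tail {n} s p = begin
  length (filter (_∈? s ∷ p) (tabulate suc))
    ≡⟨ cong (length ∘ filter (_∈? s ∷ p)) (map-tabulate id suc) ⟨
  length (filter (_∈? s ∷ p) (map suc (allFin n)))
    ≡⟨ cong length (filter-∈-map-suc s p (allFin n)) ⟩
  length (map suc (filter (_∈? p) (allFin n)))
    ≡⟨ length-map Fin.suc (filter (_∈? p) (allFin n)) ⟩
  length (filter (_∈? p) (allFin n))
    ∎
  where open ≡-Reasoning

length-filter-∈-allFin : ∀ {n} (p : Subset n) → length (filter (_∈? p) (allFin n)) ≡ ∣ p ∣
length-filter-∈-allFin [] = refl
length-filter-∈-allFin (inside ∷ p) =
  cong suc (trans (length-filter-∈-tail inside p) (length-filter-∈-allFin p))
length-filter-∈-allFin (outside ∷ p) =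
  trans (length-filter-∈-tail outside p) (length-filter-∈-allFin p)

0≤q⇒p≤q+p : ∀ {p q} → 0ℚ ℚ.≤ q → p ℚ.≤ q ℚ.+ p
0≤q⇒p≤q+p {p} {q} 0≤q = subst (ℚ._≤ q ℚ.+ p) (ℚ.+-identityˡ p) (ℚ.+-monoˡ-≤ p 0≤q)

+-cancelˡ-≤ : ∀ r {p q} → r ℚ.+ p ℚ.≤ r ℚ.+ q → p ℚ.≤ q
+-cancelˡ-≤ r r+p≤r+q =
  ℚ.≮⇒≥ (λ q<p → ℚ.<-irrefl refl (ℚ.≤-<-trans r+p≤r+q (ℚ.+-monoʳ-< r q<p)))

fromℤ-suc : ∀ m → fromℤ (+ suc m) ≡ 1ℚ ℚ.+ fromℤ (+ m)
fromℤ-suc m = sym (begin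
  1ℚ ℚ.+ fromℤ (+ m)          ≡⟨⟩
  (+ 1 ℤ.+ + m ℤ.* + 1) / 1   ≡⟨ cong (λ i → (+ 1 ℤ.+ i) / 1) (ℤ.*-identityʳ (+ m)) ⟩
  + suc m / 1                 ≡⟨ ℚ.↥p/↧p≡p (fromℤ (+ suc m)) ⟩
  fromℤ (+ suc m)             ∎)
  where open ≡-Reasoning

archimedean : ∀ p → ∃ λ m → p ℚ.≤ fromℤ (+ m)
archimedean (mkℚ (+ m) _ _) = m , *≤* (ℤ.*-monoˡ-≤-nonNeg (+ m) (+≤+ (s≤s z≤n)))
archimedean (mkℚ -[1+ _ ] _ _) = 0 , *≤* -≤+

_·2^_ : ℚ → ℕ → ℚ
R ·2^ zero = R
R ·2^ suc j = R ·2^ j ℚ.+ R ·2^ j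

≤-·2^ : ∀ {R} → 0ℚ ℚ.≤ R → ∀ j → R ℚ.≤ R ·2^ j
≤-·2^ 0≤R zero = ℚ.≤-refl
≤-·2^ {R} 0≤R (suc j) = ℚ.≤-trans R≤R·2^j (0≤q⇒p≤q+p (ℚ.≤-trans 0≤R R≤R·2^j))
  where
  R≤R·2^j : R ℚ.≤ R ·2^ j
  R≤R·2^j = ≤-·2^ 0≤R j

fromℤ-*-≤-·2^ : ∀ {r} → 0ℚ ℚ.≤ r → ∀ j → fromℤ (+ j) * r ℚ.≤ (r ℚ.+ r) ·2^ j
fromℤ-*-≤-·2^ {r} 0≤r zero =
  ℚ.≤-trans (ℚ.≤-reflexive (ℚ.*-zeroˡ r)) (ℚ.≤-trans 0≤r (0≤q⇒p≤q+p 0≤r))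
fromℤ-*-≤-·2^ {r} 0≤r (suc j) = begin
  fromℤ (+ suc j) * r                ≡⟨ cong (_* r) (fromℤ-suc j) ⟩
  (1ℚ ℚ.+ fromℤ (+ j)) * r           ≡⟨ ℚ.*-distribʳ-+ r 1ℚ (fromℤ (+ j)) ⟩
  1ℚ * r ℚ.+ fromℤ (+ j) * r         ≡⟨ cong (ℚ._+ fromℤ (+ j) * r) (ℚ.*-identityˡ r) ⟩
  r ℚ.+ fromℤ (+ j) * r              ≤⟨ ℚ.+-mono-≤ r≤ρ (fromℤ-*-≤-·2^ 0≤r j) ⟩
  (r ℚ.+ r) ·2^ j ℚ.+ (r ℚ.+ r) ·2^ j ∎
  where
  open ℚ.≤-Reasoning
  r≤r+r : r ℚ.≤ r ℚ.+ r
  r≤r+r = 0≤q⇒p≤q+p 0≤r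
  r≤ρ : r ℚ.≤ (r ℚ.+ r) ·2^ j
  r≤ρ = ℚ.≤-trans r≤r+r (≤-·2^ (ℚ.≤-trans 0≤r r≤r+r) j)

module _ {n : ℕ} (G : Graph n) where
  open Graph G

  w-nonNeg : ∀ {a b} → adj a b → 0ℚ ℚ.≤ w a b
  w-nonNeg ab = ℚ.≤-trans (ℚ.nonNegative⁻¹ 1ℚ) (w-≥1 ab)

  len-step : ∀ {a b u p} → WalkFT adj b u p → len w (a ∷ p) ≡ w a b ℚ.+ len w p
  len-step (here _) = refl
  len-step (step _ _) = refl

  len≤len-step : ∀ {a b u p} → adj a b → WalkFT adj b u p → len w p ℚ.≤ len w (a ∷ p)
  len≤len-step ab W = subst (_ ℚ.≤_) (sym (len-step W)) (0≤q⇒p≤q+p (w-nonNeg ab))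

  ∈-walk⇒d≤len : ∀ {b u q y} → WalkFT adj b u q → y ∈ q → d G y u ℚ.≤ len w q
  ∈-walk⇒d≤len W@(here _) (here refl) = sp-min _ _ _ W
  ∈-walk⇒d≤len W@(step _ _) (here refl) = sp-min _ _ _ W
  ∈-walk⇒d≤len (step ab W) (there y∈q) =
    ℚ.≤-trans (∈-walk⇒d≤len W y∈q) (len≤len-step ab W)

  ∈-walk-end : ∀ {a u q} → WalkFT adj a u q → u ∈ q
  ∈-walk-end (here _) = here refl
  ∈-walk-end (step _ W) = there (∈-walk-end W)

  sp-tail : ∀ {a b u p} → adj a b → WalkFT adj b u p → a ∷ p ≡ sp a u → p ≡ sp b u
  sp-tail {a} {b} {u} {p} ab W a∷p≡sp = sp-unique b u p W (+-cancelˡ-≤ (w a b) (begin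
    w a b ℚ.+ len w p        ≡⟨ len-step W ⟨
    len w (a ∷ p)            ≡⟨ cong (len w) a∷p≡sp ⟩
    len w (sp a u)           ≤⟨ sp-min a u _ (step ab (sp-walk b u)) ⟩
    len w (a ∷ sp b u)       ≡⟨ len-step (sp-walk b u) ⟩
    w a b ℚ.+ len w (sp b u) ∎))
    where open ℚ.≤-Reasoning

  sp-tail-∈S : ∀ {x R a b u} → adj a b → a ∷ sp b u ≡ sp a u → R ℚ.≤ d G a u →
               d G x u ℚ.≤ R ℚ.+ R → InS G x R b u
  sp-tail-∈S {a = a} {b} {u} ab a∷sp≡sp R≤dau dxu≤2R =
    a , u , (inj₂ (adj-sym ab) , inj₁ refl , R≤dau , [ a ] , [] , sp≡[a]++sp++[]) ,
    u , ∈-walk-end (sp-walk a u) , dxu≤2R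
    where
    sp≡[a]++sp++[] : sp a u ≡ a ∷ (sp b u ++ [])
    sp≡[a]++sp++[] = trans (sym a∷sp≡sp) (cong (a ∷_) (sym (++-identityʳ (sp b u))))

  module HubCover (x : Fin n) {R : ℚ} (R>0 : 0ℚ < R) (H : Subset n)
                  (H-hits : ∀ a b → InS G x R a b → ∃ λ y → y ∈ sp a b × y Sub.∈ H) where

    -- The walk is p(a,u) itself; it is an argument only to drive the recursion.
    hub-near : ∀ {u a q} → d G x u ℚ.≤ R ℚ.+ R →
               WalkFT adj a u q → q ≡ sp a u → R ℚ.≤ d G a u →
               ∃ λ c → c Sub.∈ H × d G c u ℚ.≤ R
    hub-near dxu (here _) [u]≡sp R≤duu =
      ⊥-elim (ℚ.<-irrefl refl (ℚ.<-≤-trans R>0 R≤0))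
      where
      R≤0 : R ℚ.≤ 0ℚ
      R≤0 = subst (R ℚ.≤_) (cong (len w) (sym [u]≡sp)) R≤duu
    hub-near {u} dxu (step {x = b} ab W) a∷p≡sp R≤dau with R ℚ.≤? d G b u
    ... | yes R≤dbu = hub-near dxu W (sp-tail ab W a∷p≡sp) R≤dbu
    ... | no R≰dbu
      with H-hits b u (sp-tail-∈S ab a∷sp≡sp R≤dau dxu)
      where
      a∷sp≡sp : _ ∷ sp b u ≡ sp _ u
      a∷sp≡sp = subst (λ p → _ ∷ p ≡ _) (sp-tail ab W a∷p≡sp) a∷p≡sp
    ...   | y , y∈sp , y∈H =
      y , y∈H , ℚ.≤-trans (∈-walk⇒d≤len (sp-walk b u) y∈sp) (ℚ.<⇒≤ (ℚ.≰⇒> R≰dbu))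

    ball-covered : ∀ {u} → d G x u ℚ.≤ R ℚ.+ R →
                   ∃ λ c → c ∈ x ∷ filter (_∈? H) (allFin n) × d G c u ℚ.≤ R
    ball-covered {u} dxu with d G x u ℚ.≤? R
    ... | yes dxu≤R = x , here refl , dxu≤R
    ... | no dxu≰R with hub-near dxu (sp-walk x u) refl (ℚ.<⇒≤ (ℚ.≰⇒> dxu≰R))
    ...   | c , c∈H , dcu≤R = c , there (∈-filter⁺ (_∈? H) (∈-allFin c) c∈H) , dcu≤R

  -- ballCount G C x t unfolds to length (filter (inBall? C x t) (allFin n)).
  inBall? : (C : Subset n) (x : Fin n) (t : ℚ) → Decidable (λ y → y Sub.∈ C × d G x y ℚ.≤ t)
  inBall? C x t y = (y ∈? C) ×-dec (d G x y ℚ.≤? t)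

  ballCount-double : ∀ {h R K} → HighwayDimLe G h → 0ℚ < R → (C : Subset n) →
    (∀ y → ballCount G C y R ≤ K) → ∀ x → ballCount G C x (R ℚ.+ R) ≤ suc h ℕ.* K
  ballCount-double {h} {R} {K} hd R>0 C ball≤K x with hd R R>0 x
  ... | H , ∣H∣≤h , H-hits = begin
    ballCount G C x (R ℚ.+ R)
      ≤⟨ length-filter-≤-sum (inBall? C x (R ℚ.+ R)) (λ c → inBall? C c R) centres covered
                             (allFin n) ⟩
    sum (map (λ c → ballCount G C c R) centres)
      ≤⟨ sum-map-≤ _ ball≤K centres ⟩
    length centres ℕ.* K
      ≤⟨ *-monoˡ-≤ K (s≤s (≤-trans (≤-reflexive (length-filter-∈-allFin H)) ∣H∣≤h)) ⟩
    suc h ℕ.* K ∎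
    where
    open ≤-Reasoning
    open HubCover x R>0 H H-hits
    centres : List (Fin n)
    centres = x ∷ filter (_∈? H) (allFin n)
    covered : ∀ {y} → y Sub.∈ C × d G x y ℚ.≤ R ℚ.+ R →
              ∃ λ c → c ∈ centres × (y Sub.∈ C × d G c y ℚ.≤ R)
    covered (y∈C , dxy≤2R) with ball-covered dxy≤2R
    ... | c , c∈centres , dcy≤R = c , c∈centres , y∈C , dcy≤R

  ballCount-·2^ : ∀ {h k r C} → HighwayDimLe G h → 0ℚ < r → VertexCover G r k C →
    ∀ j x → ballCount G C x ((r ℚ.+ r) ·2^ j) ≤ suc h ^ j ℕ.* k
  ballCount-·2^ {k = k} hd r>0 (_ , packing) zero x =
    ≤-trans (packing x) (≤-reflexive (sym (*-identityˡ k)))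
  ballCount-·2^ {h} {k} {r} hd r>0 vc (suc j) x = ≤-trans
    (ballCount-double hd ρ>0 _ (ballCount-·2^ hd r>0 vc j) x)
    (≤-reflexive (sym (*-assoc (suc h) (suc h ^ j) k)))
    where
    r+r>0 : 0ℚ < r ℚ.+ r
    r+r>0 = ℚ.+-mono-< r>0 r>0
    ρ>0 : 0ℚ < (r ℚ.+ r) ·2^ j
    ρ>0 = ℚ.<-≤-trans r+r>0 (≤-·2^ (ℚ.<⇒≤ r+r>0) j)

  ballCount-mono : ∀ C x {t t′} → t ℚ.≤ t′ → ballCount G C x t ≤ ballCount G C x t′
  ballCount-mono C x t≤t′ = length-filter-mono (inBall? C x _) (inBall? C x _)
    (λ (y∈C , dxy≤t) → y∈C , ℚ.≤-trans dxy≤t t≤t′) (allFin n)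

  shortcutDeg≤ballCount : ∀ C t u → shortcutDeg G C t u ≤ ballCount G C u t
  shortcutDeg≤ballCount C t u = length-filter-mono (shortcutEdge? G C t u) (inBall? C u t)
    (λ (_ , y∈C , _ , duy≤t , _) → y∈C , duy≤t) (allFin n)

  ballDegSum-bound : ∀ {h k r C r′} j → HighwayDimLe G h → 0ℚ < r → VertexCover G r k C →
    r′ ℚ.≤ (r ℚ.+ r) ·2^ j →
    ∀ v → ballDegSum G C v r′ ≤ (suc h ^ j ℕ.* k) ℕ.* (suc h ^ j ℕ.* k)
  ballDegSum-bound {h} {k} {C = C} {r′} j hd r>0 vc r′≤ρ v = begin
    ballDegSum G C v r′       ≤⟨ sum-map-≤ (shortcutDeg G C r′) deg≤K ball ⟩
    ballCount G C v r′ ℕ.* K  ≤⟨ *-monoˡ-≤ K (ball≤K v) ⟩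
    K ℕ.* K                   ∎
    where
    open ≤-Reasoning
    K : ℕ
    K = suc h ^ j ℕ.* k
    ball : List (Fin n)
    ball = filter (inBall? C v r′) (allFin n)
    ball≤K : ∀ x → ballCount G C x r′ ≤ K
    ball≤K x = ≤-trans (ballCount-mono C x r′≤ρ) (ballCount-·2^ hd r>0 vc j x)
    deg≤K : ∀ u → shortcutDeg G C r′ u ≤ K
    deg≤K u = ≤-trans (shortcutDeg≤ballCount C r′ u) (ball≤K u)

mainTheorem6 : (h k : ℕ) (λ′ : ℚ) → 0ℚ < λ′ →
    ∃ λ (c : ℕ) →
      ∀ (n : ℕ) (G : Graph n) → HighwayDimLe G h →
      ∀ (r : ℚ) → 0ℚ < r → ∀ (C : Subset n) → VertexCover G r k C →
      ∀ (r′ : ℚ) → 0ℚ < r′ → r′ Data.Rational.≤ λ′ * r →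
      ∀ (v : Fin n) → ballDegSum G C v r′ ≤ c
mainTheorem6 h k λ′ _ = K ℕ.* K , λ n G hd r r>0 C vc r′ _ r′≤λ′r →
    ballDegSum-bound G N hd r>0 vc (ℚ.≤-trans r′≤λ′r (λ′r≤ρ r>0))
  where
  N : ℕ
  N = proj₁ (archimedean λ′)
  K : ℕ
  K = suc h ^ N ℕ.* k
  λ′r≤ρ : ∀ {r} → 0ℚ < r → λ′ * r ℚ.≤ (r ℚ.+ r) ·2^ N
  λ′r≤ρ {r} r>0 = ℚ.≤-trans
    (ℚ.*-monoʳ-≤-nonNeg r {{ℚ.nonNegative (ℚ.<⇒≤ r>0)}} (proj₂ (archimedean λ′)))
    (fromℤ-*-≤-·2^ (ℚ.<⇒≤ r>0) N)
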